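{- Let $k$ be a positive integer, let $\mathcal{M}$ be a simple regular matroid of rank $r>0$ on $n$ elements, and let $M\in\mathbb{Z}^{r\times n}$ be a full-rank weakly unimodular matrix representing $\mathcal{M}$. Then the map \[(k\cdot\mathcal{P}_M^{\Delta})\cap\mathbb{Z}^r \to \{(k+1)\text{ -cuts of } M\},\qquad \mathbf{u}\mapsto M^T\mathbf{u}\] is a bijection.
   Context: A matrix $M\in\mathbb{Z}^{r\times n}$ with $0<r\le n$ is full-rank weakly unimodular if it has rank $r$ and every $r\times r$ minor lies in $\{0,\pm1\}$; it represents the matroid on $[n]$ whose independent sets are the sets of linearly independent columns. $\mathcal{P}_M\subseteq\mathbb{R}^r$ is the convex hull of the columns of $[M\mid -M]$; it is full-dimensional with the origin in its interior, and its polar is $\mathcal{P}_M^{\Delta}=\{\mathbf{u}\in\mathbb{R}^r:\mathbf{u}\cdot\mathbf{x}\le1\ \forall\mathbf{x}\in\mathcal{P}_M\}$. The lattice of integer cuts of $M$ is $\Gamma(M)=\mathrm{row}(M)\cap\mathbb{Z}^n$ (row space over $\mathbb{R}$). A $k$-cut of $M$ is an element $\boldsymbol{\gamma}\in\Gamma(M)$ with $|\gamma_i|<k$ for all $i\in[n]$. -}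

module Defs where

open import Data.Nat using (ℕ; zero; suc)
open import Data.Fin using (Fin; zero; suc; punchIn; _<_)
open import Data.Integer as ℤ using (ℤ; +_; -_; ∣_∣)
open import Data.Rational as ℚ using (ℚ; 0ℚ; 1ℚ; _/_)
open import Data.Product using (Σ; _×_; _,_; ∃)
open import Relation.Binary.PropositionalEquality using (_≡_)
open import Relation.Nullary using (¬_)
open import Data.Sum using (_⊎_)

Mat : ℕ → ℕ → Set
Mat r n = Fin r → Fin n → ℤ

toℚ : ℤ → ℚ
toℚ z = z / 1

sumℤ : ∀ {m} → (Fin m → ℤ) → ℤ
sumℤ {zero} f = + 0
sumℤ {suc m} f = f zero ℤ.+ sumℤ (λ i → f (suc i))

sumℚ : ∀ {m} → (Fin m → ℚ) → ℚ
sumℚ {zero} f = 0ℚ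
sumℚ {suc m} f = f zero ℚ.+ sumℚ (λ i → f (suc i))

sgn : ℕ → ℤ
sgn zero = + 1
sgn (suc j) = - sgn j

det : ∀ m → (Fin m → Fin m → ℤ) → ℤ
det zero A = + 1
det (suc m) A =
  sumℤ (λ j → sgn (Data.Fin.toℕ j) ℤ.* (A zero j ℤ.* det m (λ i l → A (suc i) (punchIn j l))))

StrictlyIncreasing : ∀ {r n} → (Fin r → Fin n) → Set
StrictlyIncreasing σ = ∀ i j → i < j → σ i < σ j

minor : ∀ {r n} → Mat r n → (Fin r → Fin n) → ℤ
minor {r} M σ = det r (λ i l → M i (σ l))

HasFullRowRank : ∀ {r n} → Mat r n → Set
HasFullRowRank {r} {n} M =
  ∀ (y : Fin r → ℚ) →
    (∀ j → sumℚ (λ i → y i ℚ.* toℚ (M i j)) ≡ 0ℚ) → ∀ i → y i ≡ 0ℚ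

FullRankWeaklyUnimodular : ∀ {r n} → Mat r n → Set
FullRankWeaklyUnimodular {r} {n} M =
  HasFullRowRank M ×
  (∀ (σ : Fin r → Fin n) → StrictlyIncreasing σ →
     (minor M σ ≡ + 0) ⊎ (minor M σ ≡ + 1) ⊎ (minor M σ ≡ - (+ 1)))

-- the matroid represented by M is simple:
-- no loops (column i alone is linearly dependent, i.e. zero) and
-- no parallel pairs (two distinct columns linearly dependent)
IsLoop : ∀ {r n} → Mat r n → Fin n → Set
IsLoop M i = ∀ a → M a i ≡ + 0

ParallelPair : ∀ {r n} → Mat r n → Fin n → Fin n → Set
ParallelPair M i j =
  Σ ℤ λ c → Σ ℤ λ d → ¬ (c ≡ + 0 × d ≡ + 0) ×
    (∀ a → c ℤ.* M a i ℤ.+ d ℤ.* M a j ≡ + 0)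

SimpleMatroidOf : ∀ {r n} → Mat r n → Set
SimpleMatroidOf {r} {n} M =
  (∀ i → ¬ IsLoop M i) × (∀ i j → ¬ i ≡ j → ¬ ParallelPair M i j)

-- P_M = convex hull of the columns of [M | -M]  (points with rational coordinates)
InP : ∀ {r n} → Mat r n → (Fin r → ℚ) → Set
InP {r} {n} M x =
  Σ (Fin n → ℚ) λ λ⁺ → Σ (Fin n → ℚ) λ λ⁻ →
    (∀ j → 0ℚ ℚ.≤ λ⁺ j) × (∀ j → 0ℚ ℚ.≤ λ⁻ j) ×
    (sumℚ λ⁺ ℚ.+ sumℚ λ⁻ ≡ 1ℚ) ×
    (∀ a → x a ≡ sumℚ (λ j → λ⁺ j ℚ.* toℚ (M a j) ℚ.+ λ⁻ j ℚ.* toℚ (- M a j)))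

InPolar : ∀ {r n} → Mat r n → (Fin r → ℚ) → Set
InPolar {r} M u = ∀ (x : Fin r → ℚ) → InP M x → sumℚ (λ a → u a ℚ.* x a) ℚ.≤ 1ℚ

InDilatedPolarℤ : ∀ {r n} → ℕ → Mat r n → (Fin r → ℤ) → Set
InDilatedPolarℤ {r} k M u =
  Σ (Fin r → ℚ) λ v → InPolar M v × (∀ a → toℚ (u a) ≡ toℚ (+ k) ℚ.* v a)

InCutLattice : ∀ {r n} → Mat r n → (Fin n → ℤ) → Set
InCutLattice {r} {n} M γ =
  Σ (Fin r → ℚ) λ y → ∀ j → toℚ (γ j) ≡ sumℚ (λ a → y a ℚ.* toℚ (M a j))

IsCut : ∀ {r n} → ℕ → Mat r n → (Fin n → ℤ) → Set
IsCut k M γ = InCutLattice M γ × (∀ i → Data.Nat._<_ ∣ γ i ∣ k)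

transposeApply : ∀ {r n} → Mat r n → (Fin r → ℤ) → Fin n → ℤ
transposeApply M u j = sumℤ (λ a → M a j ℤ.* u a)

-- An integer vector u lies in k·P_M^Δ iff every entry of Mᵀu has absolute value at most k, because
-- P_M is the convex hull of the columns of M and their negatives.  So u ↦ Mᵀu maps into the
-- (k+1)-cuts, and it is injective since the rows of M are linearly independent.  Conversely a cut
-- γ = Mᵀy has rational y; Gaussian elimination finds r columns of M whose minor is nonzero, hence ±1,
-- and Cramer's rule for the system on those columns shows that y is integral.
module Submission where

open import Defs
open import Data.Nat as ℕ using (ℕ; zero; suc)
import Data.Nat.Properties as ℕP
open import Data.Fin as Fin using (Fin; zero; suc; punchIn; punchOut; toℕ)
import Data.Fin.Properties as FinP
open import Data.Integer as ℤ using (ℤ; -[1+_]; ∣_∣)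
import Data.Integer.Properties as ℤP
open import Data.Rational using (ℚ; mkℚ; 0ℚ; 1ℚ; _+_; _*_; -_; _-_; _≤_; 1/_; NonZero; NonNegative; ≢-nonZero; nonNegative)
import Data.Rational.Properties as ℚP
import Data.Nat.Coprimality as Coprime
open import Data.Vec.Functional using (updateAt; removeAt)
open import Data.Vec.Functional.Properties using (updateAt-updates; updateAt-minimal; updateAt-id-local)
open import Data.Product using (Σ; _×_; _,_; proj₁; proj₂)
open import Data.Sum as Sum using (_⊎_; inj₁; inj₂)
open import Data.Empty using (⊥-elim)
open import Data.Maybe using (nothing)
open import Function using (_∘_)
open import Relation.Nullary using (yes; no)
open import Relation.Binary.PropositionalEquality
  using (_≡_; _≢_; refl; sym; trans; cong; cong₂; subst; subst₂; _≗_; module ≡-Reasoning)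
open import Algebra.Bundles using (CommutativeRing)
open import Algebra.Properties.Group ℚP.+-0-group using (x∙y⁻¹≈ε⇒x≈y)
open import Tactic.RingSolver.Core.AlmostCommutativeRing using (AlmostCommutativeRing; fromCommutativeRing)
open import Tactic.RingSolver using (solve-∀)
open import Algebra.Properties.Semiring.Sum (CommutativeRing.semiring ℚP.+-*-commutativeRing)
  using (sum; sum-cong-≗; sum-remove; ∑-distrib-+; ∑-comm; *-distribˡ-sum; sum-replicate-zero)

ℚ-ring : AlmostCommutativeRing _ _
ℚ-ring = fromCommutativeRing ℚP.+-*-commutativeRing (λ _ → nothing)

-- Unlike toℚ z = z / 1, which normalises through a gcd, fromℤ computes on open terms.
fromℤ : ℤ → ℚ
fromℤ z = mkℚ z 0 (Coprime.sym (Coprime.1-coprimeTo ∣ z ∣))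

toℚ≡fromℤ : ∀ z → toℚ z ≡ fromℤ z
toℚ≡fromℤ z = ℚP.fromℚᵘ-toℚᵘ (fromℤ z)

toℚ-+ : ∀ a b → toℚ (a ℤ.+ b) ≡ toℚ a + toℚ b
toℚ-+ a b rewrite toℚ≡fromℤ a | toℚ≡fromℤ b =
  sym (cong toℚ (cong₂ ℤ._+_ (ℤP.*-identityʳ a) (ℤP.*-identityʳ b)))

toℚ-* : ∀ a b → toℚ (a ℤ.* b) ≡ toℚ a * toℚ b
toℚ-* a b rewrite toℚ≡fromℤ a | toℚ≡fromℤ b = refl

toℚ-neg : ∀ a → toℚ (ℤ.- a) ≡ - toℚ a
toℚ-neg a rewrite toℚ≡fromℤ a | toℚ≡fromℤ (ℤ.- a) = fromℤ-neg a
  where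
  fromℤ-neg : ∀ a → fromℤ (ℤ.- a) ≡ - fromℤ a
  fromℤ-neg (ℤ.+ zero) = refl
  fromℤ-neg (ℤ.+ suc n) = refl
  fromℤ-neg -[1+ n ] = refl

toℚ-injective : ∀ {a b} → toℚ a ≡ toℚ b → a ≡ b
toℚ-injective {a} {b} e rewrite toℚ≡fromℤ a | toℚ≡fromℤ b = cong Data.Rational.↥_ e

toℚ-mono-≤ : ∀ {a b} → a ℤ.≤ b → toℚ a ≤ toℚ b
toℚ-mono-≤ {a} {b} le rewrite toℚ≡fromℤ a | toℚ≡fromℤ b =
  Data.Rational.*≤* (subst₂ ℤ._≤_ (sym (ℤP.*-identityʳ a)) (sym (ℤP.*-identityʳ b)) le)

toℚ-cancel-≤ : ∀ {a b} → toℚ a ≤ toℚ b → a ℤ.≤ b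
toℚ-cancel-≤ {a} {b} le rewrite toℚ≡fromℤ a | toℚ≡fromℤ b with le
... | Data.Rational.*≤* p = subst₂ ℤ._≤_ (ℤP.*-identityʳ a) (ℤP.*-identityʳ b) p

sumℚ≡sum : ∀ {m} (f : Fin m → ℚ) → sumℚ f ≡ sum f
sumℚ≡sum {zero} f = refl
sumℚ≡sum {suc m} f = cong (f zero +_) (sumℚ≡sum (f ∘ suc))

sumℚ-cong : ∀ {m} {f g : Fin m → ℚ} → f ≗ g → sumℚ f ≡ sumℚ g
sumℚ-cong {zero} e = refl
sumℚ-cong {suc m} e = cong₂ _+_ (e zero) (sumℚ-cong (e ∘ suc))

sumℚ-distrib-+ : ∀ {m} (f g : Fin m → ℚ) → sumℚ (λ i → f i + g i) ≡ sumℚ f + sumℚ g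
sumℚ-distrib-+ f g = begin
  sumℚ (λ i → f i + g i) ≡⟨ sumℚ≡sum (λ i → f i + g i) ⟩
  sum (λ i → f i + g i)  ≡⟨ ∑-distrib-+ f g ⟩
  sum f + sum g          ≡⟨ sym (cong₂ _+_ (sumℚ≡sum f) (sumℚ≡sum g)) ⟩
  sumℚ f + sumℚ g        ∎
  where open ≡-Reasoning

*-distribˡ-sumℚ : ∀ {m} (c : ℚ) (f : Fin m → ℚ) → sumℚ (λ i → c * f i) ≡ c * sumℚ f
*-distribˡ-sumℚ c f = begin
  sumℚ (λ i → c * f i) ≡⟨ sumℚ≡sum (λ i → c * f i) ⟩
  sum (λ i → c * f i)  ≡⟨ sym (*-distribˡ-sum c f) ⟩
  c * sum f            ≡⟨ cong (c *_) (sym (sumℚ≡sum f)) ⟩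
  c * sumℚ f           ∎
  where open ≡-Reasoning

sumℚ-zero : ∀ m → sumℚ {m} (λ _ → 0ℚ) ≡ 0ℚ
sumℚ-zero m = trans (sumℚ≡sum {m} (λ _ → 0ℚ)) (sum-replicate-zero m)

sumℚ-neg : ∀ {m} (f : Fin m → ℚ) → sumℚ (λ i → - f i) ≡ - sumℚ f
sumℚ-neg {zero} f = refl
sumℚ-neg {suc m} f =
  trans (cong (- f zero +_) (sumℚ-neg (f ∘ suc))) (sym (ℚP.neg-distrib-+ (f zero) _))

sumℚ-comm : ∀ {m n} (f : Fin m → Fin n → ℚ) →
  sumℚ (λ i → sumℚ (f i)) ≡ sumℚ (λ j → sumℚ (λ i → f i j))
sumℚ-comm f = begin
  sumℚ (λ i → sumℚ (f i))          ≡⟨ nested f ⟩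
  sum (λ i → sum (f i))            ≡⟨ ∑-comm f ⟩
  sum (λ j → sum (λ i → f i j))    ≡⟨ sym (nested (λ j i → f i j)) ⟩
  sumℚ (λ j → sumℚ (λ i → f i j))  ∎
  where
  open ≡-Reasoning
  nested : ∀ {m n} (g : Fin m → Fin n → ℚ) → sumℚ (λ i → sumℚ (g i)) ≡ sum (λ i → sum (g i))
  nested g = trans (sumℚ≡sum (λ i → sumℚ (g i))) (sum-cong-≗ (sumℚ≡sum ∘ g))

sumℚ-remove : ∀ {n} (f : Fin (suc n) → ℚ) (j : Fin (suc n)) → sumℚ f ≡ f j + sumℚ (removeAt f j)
sumℚ-remove f j = begin
  sumℚ f                         ≡⟨ sumℚ≡sum f ⟩
  sum f                          ≡⟨ sum-remove f ⟩
  f j + sum (removeAt f j)       ≡⟨ cong (f j +_) (sym (sumℚ≡sum (removeAt f j))) ⟩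
  f j + sumℚ (removeAt f j)      ∎
  where open ≡-Reasoning

sumℚ-linear : ∀ {m} (a b : ℚ) {f g h : Fin m → ℚ} → (∀ j → h j ≡ a * f j + b * g j) →
  sumℚ h ≡ a * sumℚ f + b * sumℚ g
sumℚ-linear a b {f} {g} e = trans (sumℚ-cong e)
  (trans (sumℚ-distrib-+ (λ j → a * f j) (λ j → b * g j)) (cong₂ _+_ (*-distribˡ-sumℚ a f) (*-distribˡ-sumℚ b g)))

sumℚ-mono-≤ : ∀ {m} {f g : Fin m → ℚ} → (∀ i → f i ≤ g i) → sumℚ f ≤ sumℚ g
sumℚ-mono-≤ {zero} h = ℚP.≤-refl
sumℚ-mono-≤ {suc m} h = ℚP.+-mono-≤ (h zero) (sumℚ-mono-≤ (h ∘ suc))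

sumℚ-single : ∀ {m} (f : Fin m → ℚ) (i : Fin m) → (∀ a → a ≢ i → f a ≡ 0ℚ) → sumℚ f ≡ f i
sumℚ-single {suc m} f i h = begin
  sumℚ f                         ≡⟨ sumℚ-remove f i ⟩
  f i + sumℚ (removeAt f i)      ≡⟨ cong (f i +_) (sumℚ-cong (λ l → h (punchIn i l) (FinP.punchInᵢ≢i i l))) ⟩
  f i + sumℚ {m} (λ _ → 0ℚ)      ≡⟨ cong (f i +_) (sumℚ-zero m) ⟩
  f i + 0ℚ                       ≡⟨ ℚP.+-identityʳ (f i) ⟩
  f i                            ∎
  where open ≡-Reasoning

toℚ-sumℤ : ∀ {m} (f : Fin m → ℤ) → toℚ (sumℤ f) ≡ sumℚ (toℚ ∘ f)
toℚ-sumℤ {zero} f = refl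
toℚ-sumℤ {suc m} f = trans (toℚ-+ (f zero) _) (cong (toℚ (f zero) +_) (toℚ-sumℤ (f ∘ suc)))

-- Determinants over ℚ

Square : ℕ → Set
Square m = Fin m → Fin m → ℚ

submatrix₀ : ∀ {m} → Square (suc m) → Fin (suc m) → Square m
submatrix₀ A j i l = A (suc i) (punchIn j l)

sgnℚ : ℕ → ℚ
sgnℚ zero = 1ℚ
sgnℚ (suc j) = - sgnℚ j

sgnℚ≢0 : ∀ k → sgnℚ k ≢ 0ℚ
sgnℚ≢0 zero ()
sgnℚ≢0 (suc k) -s≡0 = sgnℚ≢0 k (ℚP.neg-injective -s≡0)

detℚ : ∀ m → Square m → ℚ
detℚ zero A = 1ℚ
detℚ (suc m) A = sumℚ (λ j → sgnℚ (toℕ j) * (A zero j * detℚ m (submatrix₀ A j)))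

toℚ-det : ∀ m (A : Fin m → Fin m → ℤ) → toℚ (det m A) ≡ detℚ m (λ i j → toℚ (A i j))
toℚ-det zero A = refl
toℚ-det (suc m) A = trans (toℚ-sumℤ term) (sumℚ-cong λ j →
  trans (toℚ-* (sgn (toℕ j)) (A zero j ℤ.* minorDet j)) (cong₂ _*_ (toℚ-sgn (toℕ j))
    (trans (toℚ-* (A zero j) (minorDet j)) (cong (toℚ (A zero j) *_) (toℚ-det m (λ i l → A (suc i) (punchIn j l)))))))
  where
  toℚ-sgn : ∀ j → toℚ (sgn j) ≡ sgnℚ j
  toℚ-sgn zero = refl
  toℚ-sgn (suc j) = trans (toℚ-neg (sgn j)) (cong -_ (toℚ-sgn j))
  minorDet : Fin (suc m) → ℤ
  minorDet j = det m (λ i l → A (suc i) (punchIn j l))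
  term : Fin (suc m) → ℤ
  term j = sgn (toℕ j) ℤ.* (A zero j ℤ.* minorDet j)

detℚ-cong : ∀ m {A B : Square m} → (∀ i j → A i j ≡ B i j) → detℚ m A ≡ detℚ m B
detℚ-cong zero e = refl
detℚ-cong (suc m) e = sumℚ-cong λ j →
  cong₂ (λ x y → sgnℚ (toℕ j) * (x * y)) (e zero j) (detℚ-cong m (λ i l → e (suc i) (punchIn j l)))

RowsAgreeExcept : ∀ {m} → Fin m → Square m → Square m → Set
RowsAgreeExcept r A B = ∀ i → i ≢ r → A i ≗ B i

RowsAgreeExcept-submatrix₀ : ∀ {m} {r : Fin m} {A B : Square (suc m)} → RowsAgreeExcept (suc r) A B →
  ∀ j → RowsAgreeExcept r (submatrix₀ A j) (submatrix₀ B j)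
RowsAgreeExcept-submatrix₀ A≈B j i i≢r l = A≈B (suc i) (i≢r ∘ FinP.suc-injective) (punchIn j l)

detℚ-linearAt : ∀ m (r : Fin m) (a b : ℚ) {A B C : Square m} →
  RowsAgreeExcept r C A → RowsAgreeExcept r C B → (∀ j → C r j ≡ a * A r j + b * B r j) →
  detℚ m C ≡ a * detℚ m A + b * detℚ m B
detℚ-linearAt (suc m) zero a b {A} {B} {C} C≈A C≈B Cr = sumℚ-linear a b λ j →
  let s = sgnℚ (toℕ j)
      d = detℚ m (submatrix₀ A j)
      d≡dA = detℚ-cong m (λ i l → C≈A (suc i) (λ ()) (punchIn j l))
      d≡dB = detℚ-cong m (λ i l → C≈B (suc i) (λ ()) (punchIn j l))
  in begin
    s * (C zero j * detℚ m (submatrix₀ C j))       ≡⟨ cong₂ (λ x y → s * (x * y)) (Cr j) d≡dA ⟩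
    s * ((a * A zero j + b * B zero j) * d)        ≡⟨ distribute s a b (A zero j) (B zero j) d ⟩
    a * (s * (A zero j * d)) + b * (s * (B zero j * d))
      ≡⟨ cong (λ z → a * (s * (A zero j * d)) + b * (s * (B zero j * z))) (trans (sym d≡dA) d≡dB) ⟩
    a * (s * (A zero j * d)) + b * (s * (B zero j * detℚ m (submatrix₀ B j))) ∎
  where
  open ≡-Reasoning
  distribute : ∀ s a b x y d → s * ((a * x + b * y) * d) ≡ a * (s * (x * d)) + b * (s * (y * d))
  distribute = solve-∀ ℚ-ring
detℚ-linearAt (suc m) (suc r) a b {A} {B} {C} C≈A C≈B Cr = sumℚ-linear a b λ j →
  let s = sgnℚ (toℕ j)
      c = C zero j
  in begin
    s * (c * detℚ m (submatrix₀ C j))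
      ≡⟨ cong (λ z → s * (c * z)) (detℚ-linearAt m r a b
           (RowsAgreeExcept-submatrix₀ C≈A j) (RowsAgreeExcept-submatrix₀ C≈B j) (Cr ∘ punchIn j)) ⟩
    s * (c * (a * detℚ m (submatrix₀ A j) + b * detℚ m (submatrix₀ B j)))
      ≡⟨ distribute s c a b (detℚ m (submatrix₀ A j)) (detℚ m (submatrix₀ B j)) ⟩
    a * (s * (c * detℚ m (submatrix₀ A j))) + b * (s * (c * detℚ m (submatrix₀ B j)))
      ≡⟨ cong₂ (λ x y → a * (s * (x * detℚ m (submatrix₀ A j))) + b * (s * (y * detℚ m (submatrix₀ B j))))
           (C≈A zero (λ ()) j) (C≈B zero (λ ()) j) ⟩
    a * (s * (A zero j * detℚ m (submatrix₀ A j))) + b * (s * (B zero j * detℚ m (submatrix₀ B j))) ∎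
  where
  open ≡-Reasoning
  distribute : ∀ s c a b x y → s * (c * (a * x + b * y)) ≡ a * (s * (c * x)) + b * (s * (c * y))
  distribute = solve-∀ ℚ-ring

x*[y*0]≡0 : ∀ x y → x * (y * 0ℚ) ≡ 0ℚ
x*[y*0]≡0 x y = trans (cong (x *_) (ℚP.*-zeroʳ y)) (ℚP.*-zeroʳ x)

detℚ-zeroColumn : ∀ m (A : Square m) (c : Fin m) → (∀ i → A i c ≡ 0ℚ) → detℚ m A ≡ 0ℚ
detℚ-zeroColumn (suc m) A c Ac≡0 = trans (sumℚ-cong term≡0) (sumℚ-zero (suc m))
  where
  term≡0 : ∀ j → sgnℚ (toℕ j) * (A zero j * detℚ m (submatrix₀ A j)) ≡ 0ℚ
  term≡0 j with j Fin.≟ c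
  ... | yes refl = trans (cong (λ x → sgnℚ (toℕ j) * (x * detℚ m (submatrix₀ A j))) (Ac≡0 zero))
                         (trans (cong (sgnℚ (toℕ j) *_) (ℚP.*-zeroˡ (detℚ m (submatrix₀ A j))))
                                (ℚP.*-zeroʳ (sgnℚ (toℕ j))))
  ... | no j≢c = trans (cong (λ x → sgnℚ (toℕ j) * (A zero j * x)) (detℚ-zeroColumn m _ (punchOut j≢c)
                         (λ i → trans (cong (A (suc i)) (FinP.punchIn-punchOut j≢c)) (Ac≡0 (suc i)))))
                       (x*[y*0]≡0 (sgnℚ (toℕ j)) (A zero j))

detℚ-pivotColumn : ∀ m (A : Square (suc m)) (p : Fin (suc m)) → (∀ i → A (suc i) p ≡ 0ℚ) →
  detℚ (suc m) A ≡ sgnℚ (toℕ p) * (A zero p * detℚ m (submatrix₀ A p))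
detℚ-pivotColumn m A p column≡0 = sumℚ-single _ p λ q q≢p →
  trans (cong (λ d → sgnℚ (toℕ q) * (A zero q * d))
          (detℚ-zeroColumn m (submatrix₀ A q) (punchOut q≢p)
            (λ i → trans (cong (A (suc i)) (FinP.punchIn-punchOut q≢p)) (column≡0 i))))
        (x*[y*0]≡0 (sgnℚ (toℕ q)) (A zero q))

punchIn-punchOut-comm : ∀ {n} (j k : Fin (suc (suc n))) (j≢k : j ≢ k) (k≢j : k ≢ j) (x : Fin n) →
  punchIn j (punchIn (punchOut j≢k) x) ≡ punchIn k (punchIn (punchOut k≢j) x)
punchIn-punchOut-comm zero zero j≢k _ x = ⊥-elim (j≢k refl)
punchIn-punchOut-comm zero (suc k) _ _ x = refl
punchIn-punchOut-comm (suc j) zero _ _ x = refl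
punchIn-punchOut-comm {zero} (suc zero) (suc zero) j≢k _ x = ⊥-elim (j≢k refl)
punchIn-punchOut-comm {suc n} (suc j) (suc k) _ _ zero = refl
punchIn-punchOut-comm {suc n} (suc j) (suc k) _ _ (suc x) = cong suc (punchIn-punchOut-comm j k _ _ x)

sgnℚ-punchOut-antisym : ∀ {n} (j k : Fin (suc (suc n))) (j≢k : j ≢ k) (k≢j : k ≢ j) →
  sgnℚ (toℕ j) * sgnℚ (toℕ (punchOut j≢k)) ≡ - (sgnℚ (toℕ k) * sgnℚ (toℕ (punchOut k≢j)))
sgnℚ-punchOut-antisym zero zero j≢k _ = ⊥-elim (j≢k refl)
sgnℚ-punchOut-antisym zero (suc k) _ _ = one*a≡-[-a*one] (sgnℚ (toℕ k))
  where
  one*a≡-[-a*one] : ∀ a → 1ℚ * a ≡ - ((- a) * 1ℚ)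
  one*a≡-[-a*one] = solve-∀ ℚ-ring
sgnℚ-punchOut-antisym (suc j) zero _ _ = -a*one≡-[one*a] (sgnℚ (toℕ j))
  where
  -a*one≡-[one*a] : ∀ a → (- a) * 1ℚ ≡ - (1ℚ * a)
  -a*one≡-[one*a] = solve-∀ ℚ-ring
sgnℚ-punchOut-antisym {zero} (suc zero) (suc zero) j≢k _ = ⊥-elim (j≢k refl)
sgnℚ-punchOut-antisym {suc n} (suc j) (suc k) j≢k k≢j =
  trans (neg*neg (sgnℚ (toℕ j)) _)
    (trans (sgnℚ-punchOut-antisym j k (j≢k ∘ cong suc) (k≢j ∘ cong suc)) (cong -_ (sym (neg*neg (sgnℚ (toℕ k)) _))))
  where
  neg*neg : ∀ a b → (- a) * (- b) ≡ a * b
  neg*neg = solve-∀ ℚ-ring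

swapRows₀₁ : ∀ {m} → Square (suc (suc m)) → Square (suc (suc m))
swapRows₀₁ A zero = A (suc zero)
swapRows₀₁ A (suc zero) = A zero
swapRows₀₁ A (suc (suc i)) = A (suc (suc i))

-- The summand of the Laplace expansion of det A along its first two rows with row 0 in column j and row 1 in column k.
pairTerm : ∀ {m} → Square (suc (suc m)) → Fin (suc (suc m)) → Fin (suc (suc m)) → ℚ
pairTerm {m} A j k with j Fin.≟ k
... | yes _ = 0ℚ
... | no j≢k = (sgnℚ (toℕ j) * sgnℚ (toℕ (punchOut j≢k)))
             * (A zero j * (A (suc zero) k * detℚ m (λ i x → A (suc (suc i)) (punchIn j (punchIn (punchOut j≢k) x)))))

detℚ-expand₂ : ∀ m (A : Square (suc (suc m))) → detℚ (suc (suc m)) A ≡ sumℚ (λ j → sumℚ (pairTerm A j))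
detℚ-expand₂ m A = sumℚ-cong λ j → begin
  sgnℚ (toℕ j) * (A zero j * sumℚ (T j))                 ≡⟨ cong (sgnℚ (toℕ j) *_) (sym (*-distribˡ-sumℚ (A zero j) (T j))) ⟩
  sgnℚ (toℕ j) * sumℚ (λ l → A zero j * T j l)           ≡⟨ sym (*-distribˡ-sumℚ (sgnℚ (toℕ j)) (λ l → A zero j * T j l)) ⟩
  sumℚ (λ l → sgnℚ (toℕ j) * (A zero j * T j l))         ≡⟨ sumℚ-cong (λ l → sym (pairTerm-punchIn j l)) ⟩
  sumℚ (λ l → pairTerm A j (punchIn j l))                ≡⟨ sym (ℚP.+-identityˡ _) ⟩
  0ℚ + sumℚ (removeAt (pairTerm A j) j)                  ≡⟨ cong (_+ sumℚ (removeAt (pairTerm A j) j)) (sym (pairTerm-diagonal j)) ⟩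
  pairTerm A j j + sumℚ (removeAt (pairTerm A j) j)      ≡⟨ sym (sumℚ-remove (pairTerm A j) j) ⟩
  sumℚ (pairTerm A j)                                    ∎
  where
  open ≡-Reasoning
  D : Fin (suc (suc m)) → Fin (suc m) → ℚ
  D j l = detℚ m (λ i x → A (suc (suc i)) (punchIn j (punchIn l x)))
  T : Fin (suc (suc m)) → Fin (suc m) → ℚ
  T j l = sgnℚ (toℕ l) * (A (suc zero) (punchIn j l) * D j l)
  pairTerm-diagonal : ∀ j → pairTerm A j j ≡ 0ℚ
  pairTerm-diagonal j with j Fin.≟ j
  ... | yes _ = refl
  ... | no j≢j = ⊥-elim (j≢j refl)
  reassociate : ∀ s t a b d → (s * t) * (a * (b * d)) ≡ s * (a * (t * (b * d)))
  reassociate = solve-∀ ℚ-ring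
  pairTerm-punchIn : ∀ j l → pairTerm A j (punchIn j l) ≡ sgnℚ (toℕ j) * (A zero j * T j l)
  pairTerm-punchIn j l with j Fin.≟ punchIn j l
  ... | yes j≡j′ = ⊥-elim (FinP.punchInᵢ≢i j l (sym j≡j′))
  ... | no j≢j′ = trans
    (cong (λ z → (sgnℚ (toℕ j) * sgnℚ (toℕ z)) * (A zero j * (A (suc zero) (punchIn j l) * D j z)))
          (trans (FinP.punchOut-cong j refl) (FinP.punchOut-punchIn j)))
    (reassociate (sgnℚ (toℕ j)) (sgnℚ (toℕ l)) (A zero j) (A (suc zero) (punchIn j l)) (D j l))

pairTerm-swapRows₀₁ : ∀ {m} (A : Square (suc (suc m))) j k → pairTerm (swapRows₀₁ A) j k ≡ - pairTerm A k j
pairTerm-swapRows₀₁ {m} A j k with j Fin.≟ k | k Fin.≟ j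
... | yes _ | yes _ = refl
... | yes j≡k | no k≢j = ⊥-elim (k≢j (sym j≡k))
... | no j≢k | yes k≡j = ⊥-elim (j≢k (sym k≡j))
... | no j≢k | no k≢j = begin
  (sgnℚ (toℕ j) * sgnℚ (toℕ (punchOut j≢k))) * (A (suc zero) j * (A zero k * D j j≢k))
    ≡⟨ cong (λ z → (sgnℚ (toℕ j) * sgnℚ (toℕ (punchOut j≢k))) * (A (suc zero) j * (A zero k * z)))
         (detℚ-cong m (λ i x → cong (A (suc (suc i))) (punchIn-punchOut-comm j k j≢k k≢j x))) ⟩
  (sgnℚ (toℕ j) * sgnℚ (toℕ (punchOut j≢k))) * (A (suc zero) j * (A zero k * D k k≢j))
    ≡⟨ cong (_* (A (suc zero) j * (A zero k * D k k≢j))) (sgnℚ-punchOut-antisym j k j≢k k≢j) ⟩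
  (- (sgnℚ (toℕ k) * sgnℚ (toℕ (punchOut k≢j)))) * (A (suc zero) j * (A zero k * D k k≢j))
    ≡⟨ exchange (sgnℚ (toℕ k) * sgnℚ (toℕ (punchOut k≢j))) (A (suc zero) j) (A zero k) (D k k≢j) ⟩
  - ((sgnℚ (toℕ k) * sgnℚ (toℕ (punchOut k≢j))) * (A zero k * (A (suc zero) j * D k k≢j))) ∎
  where
  open ≡-Reasoning
  D : ∀ j {k} → j ≢ k → ℚ
  D j j≢k = detℚ m (λ i x → A (suc (suc i)) (punchIn j (punchIn (punchOut j≢k) x)))
  exchange : ∀ s a b d → (- s) * (a * (b * d)) ≡ - (s * (b * (a * d)))
  exchange = solve-∀ ℚ-ring

detℚ-swapRows₀₁ : ∀ m (A : Square (suc (suc m))) → detℚ (suc (suc m)) (swapRows₀₁ A) ≡ - detℚ (suc (suc m)) A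
detℚ-swapRows₀₁ m A = begin
  detℚ (suc (suc m)) (swapRows₀₁ A)                      ≡⟨ detℚ-expand₂ m (swapRows₀₁ A) ⟩
  sumℚ (λ j → sumℚ (pairTerm (swapRows₀₁ A) j))          ≡⟨ sumℚ-cong (λ j → sumℚ-cong (pairTerm-swapRows₀₁ A j)) ⟩
  sumℚ (λ j → sumℚ (λ k → - pairTerm A k j))             ≡⟨ sumℚ-cong (λ j → sumℚ-neg (λ k → pairTerm A k j)) ⟩
  sumℚ (λ j → - sumℚ (λ k → pairTerm A k j))             ≡⟨ sumℚ-neg (λ j → sumℚ (λ k → pairTerm A k j)) ⟩
  - sumℚ (λ j → sumℚ (λ k → pairTerm A k j))             ≡⟨ cong -_ (sym (sumℚ-comm (pairTerm A))) ⟩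
  - sumℚ (λ k → sumℚ (pairTerm A k))                     ≡⟨ cong -_ (sym (detℚ-expand₂ m A)) ⟩
  - detℚ (suc (suc m)) A                                 ∎
  where open ≡-Reasoning

x≡-x⇒x≡0 : ∀ {x} → x ≡ - x → x ≡ 0ℚ
x≡-x⇒x≡0 {x} x≡-x = begin
  x                  ≡⟨ sym (ℚP.*-identityˡ x) ⟩
  1ℚ * x             ≡⟨ cong (_* x) (sym (ℚP.*-inverseˡ two)) ⟩
  (1/ two * two) * x ≡⟨ ℚP.*-assoc (1/ two) two x ⟩
  1/ two * (two * x) ≡⟨ cong (1/ two *_) (trans (ℚP.*-distribʳ-+ x 1ℚ 1ℚ) (cong₂ _+_ (ℚP.*-identityˡ x) (ℚP.*-identityˡ x))) ⟩
  1/ two * (x + x)   ≡⟨ cong (λ y → 1/ two * (x + y)) x≡-x ⟩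
  1/ two * (x - x)   ≡⟨ cong (1/ two *_) (ℚP.+-inverseʳ x) ⟩
  1/ two * 0ℚ        ≡⟨ ℚP.*-zeroʳ (1/ two) ⟩
  0ℚ                 ∎
  where
  open ≡-Reasoning
  two : ℚ
  two = 1ℚ + 1ℚ

detℚ-equalRows : ∀ m (A : Square m) (i k : Fin m) → i ≢ k → A i ≗ A k → detℚ m A ≡ 0ℚ
detℚ-laterRowsEqual : ∀ m (A : Square (suc m)) (i k : Fin m) → i ≢ k → A (suc i) ≗ A (suc k) → detℚ (suc m) A ≡ 0ℚ
detℚ-firstRowRepeated : ∀ m (A : Square (suc m)) (k : Fin m) → A zero ≗ A (suc k) → detℚ (suc m) A ≡ 0ℚ

detℚ-equalRows (suc m) A zero zero i≢k _ = ⊥-elim (i≢k refl)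
detℚ-equalRows (suc m) A zero (suc k) _ A₀≗Aₖ = detℚ-firstRowRepeated m A k A₀≗Aₖ
detℚ-equalRows (suc m) A (suc i) zero _ Aᵢ≗A₀ = detℚ-firstRowRepeated m A i (sym ∘ Aᵢ≗A₀)
detℚ-equalRows (suc m) A (suc i) (suc k) i≢k Aᵢ≗Aₖ = detℚ-laterRowsEqual m A i k (i≢k ∘ cong suc) Aᵢ≗Aₖ

detℚ-laterRowsEqual m A i k i≢k Aᵢ≗Aₖ = trans (sumℚ-cong term≡0) (sumℚ-zero (suc m))
  where
  term≡0 : ∀ j → sgnℚ (toℕ j) * (A zero j * detℚ m (submatrix₀ A j)) ≡ 0ℚ
  term≡0 j = begin
    sgnℚ (toℕ j) * (A zero j * detℚ m (submatrix₀ A j))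
      ≡⟨ cong (λ d → sgnℚ (toℕ j) * (A zero j * d)) (detℚ-equalRows m (submatrix₀ A j) i k i≢k (Aᵢ≗Aₖ ∘ punchIn j)) ⟩
    sgnℚ (toℕ j) * (A zero j * 0ℚ) ≡⟨ x*[y*0]≡0 (sgnℚ (toℕ j)) (A zero j) ⟩
    0ℚ                             ∎
    where open ≡-Reasoning

detℚ-firstRowRepeated (suc m) A zero A₀≗A₁ =
  x≡-x⇒x≡0 (trans (detℚ-cong (suc (suc m)) A≡swapped) (detℚ-swapRows₀₁ m A))
  where
  A≡swapped : ∀ i j → A i j ≡ swapRows₀₁ A i j
  A≡swapped zero j = A₀≗A₁ j
  A≡swapped (suc zero) j = sym (A₀≗A₁ j)
  A≡swapped (suc (suc i)) j = refl
detℚ-firstRowRepeated (suc m) A (suc k) A₀≗Aₖ = begin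
  detℚ (suc (suc m)) A                              ≡⟨ detℚ-cong (suc (suc m)) swapped-twice ⟩
  detℚ (suc (suc m)) (swapRows₀₁ (swapRows₀₁ A))    ≡⟨ detℚ-swapRows₀₁ m (swapRows₀₁ A) ⟩
  - detℚ (suc (suc m)) (swapRows₀₁ A)               ≡⟨ cong -_ (detℚ-laterRowsEqual (suc m) (swapRows₀₁ A) zero (suc k) (λ ()) A₀≗Aₖ) ⟩
  - 0ℚ                                              ≡⟨⟩
  0ℚ                                                ∎
  where
  open ≡-Reasoning
  swapped-twice : ∀ i j → A i j ≡ swapRows₀₁ (swapRows₀₁ A) i j
  swapped-twice zero j = refl
  swapped-twice (suc zero) j = refl
  swapped-twice (suc (suc i)) j = refl

setRow : ∀ {m} → Square m → Fin m → (Fin m → ℚ) → Square m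
setRow A i v = updateAt A i (λ _ → v)

setRow-agreesExcept : ∀ {m} (A : Square m) i v → RowsAgreeExcept i (setRow A i v) A
setRow-agreesExcept A i v k k≢i l = cong (λ row → row l) (updateAt-minimal k i A k≢i)

setRow-updates : ∀ {m} (A : Square m) i v → setRow A i v i ≗ v
setRow-updates A i v l = cong (λ row → row l) (updateAt-updates i A)

RowsAgreeExcept-setRow : ∀ {m} {i : Fin m} {B C : Square m} v → RowsAgreeExcept i C B → RowsAgreeExcept i C (setRow B i v)
RowsAgreeExcept-setRow {B = B} v C≈B k k≢i l = trans (C≈B k k≢i l) (sym (setRow-agreesExcept B _ v k k≢i l))

detℚ-setRow-repeated : ∀ m (B : Square m) (i k : Fin m) → i ≢ k → detℚ m (setRow B i (B k)) ≡ 0ℚ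
detℚ-setRow-repeated m B i k i≢k = detℚ-equalRows m (setRow B i (B k)) i k i≢k
  (λ l → trans (setRow-updates B i (B k) l) (sym (setRow-agreesExcept B i (B k) k (i≢k ∘ sym) l)))

detℚ-rowCombination : ∀ m {m′} (B C : Square m) (i : Fin m) (y : Fin m′ → ℚ) (R : Fin m′ → Fin m → ℚ) →
  RowsAgreeExcept i C B → (∀ j → C i j ≡ sumℚ (λ t → y t * R t j)) →
  detℚ m C ≡ sumℚ (λ t → y t * detℚ m (setRow B i (R t)))
detℚ-rowCombination m {zero} B C i y R C≈B Ci≡0 = begin
  detℚ m C                           ≡⟨ detℚ-linearAt m i 0ℚ 0ℚ C≈B C≈B (λ j → trans (Ci≡0 j) (sym (zeros (B i j)))) ⟩
  0ℚ * detℚ m B + 0ℚ * detℚ m B      ≡⟨ zeros (detℚ m B) ⟩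
  0ℚ                                 ∎
  where
  open ≡-Reasoning
  zeros : ∀ a → 0ℚ * a + 0ℚ * a ≡ 0ℚ
  zeros a = cong₂ _+_ (ℚP.*-zeroˡ a) (ℚP.*-zeroˡ a)
detℚ-rowCombination m {suc m′} B C i y R C≈B Ci≡comb = begin
  detℚ m C
    ≡⟨ detℚ-linearAt m i (y zero) 1ℚ (RowsAgreeExcept-setRow (R zero) C≈B) (RowsAgreeExcept-setRow rest C≈B)
         (λ j → trans (Ci≡comb j) (cong₂ (λ a b → y zero * a + b)
                  (sym (setRow-updates B i (R zero) j))
                  (sym (trans (ℚP.*-identityˡ _) (setRow-updates B i rest j))))) ⟩
  y zero * detℚ m (setRow B i (R zero)) + 1ℚ * detℚ m (setRow B i rest)
    ≡⟨ cong (y zero * detℚ m (setRow B i (R zero)) +_) (trans (ℚP.*-identityˡ _)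
         (detℚ-rowCombination m B (setRow B i rest) i (y ∘ suc) (R ∘ suc)
           (setRow-agreesExcept B i rest) (setRow-updates B i rest))) ⟩
  y zero * detℚ m (setRow B i (R zero)) + sumℚ (λ t → y (suc t) * detℚ m (setRow B i (R (suc t)))) ∎
  where
  open ≡-Reasoning
  rest : Fin m → ℚ
  rest j = sumℚ (λ t → y (suc t) * R (suc t) j)

detℚ-cramer : ∀ m (B C : Square m) (i : Fin m) (y : Fin m → ℚ) →
  RowsAgreeExcept i C B → (∀ j → C i j ≡ sumℚ (λ a → y a * B a j)) → detℚ m C ≡ y i * detℚ m B
detℚ-cramer m B C i y C≈B Ci≡comb = begin
  detℚ m C                                           ≡⟨ detℚ-rowCombination m B C i y B C≈B Ci≡comb ⟩
  sumℚ (λ t → y t * detℚ m (setRow B i (B t)))       ≡⟨ sumℚ-single _ i repeatedRow≡0 ⟩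
  y i * detℚ m (setRow B i (B i))
    ≡⟨ cong (y i *_) (detℚ-cong m (λ k l → cong (λ row → row l) (updateAt-id-local i B refl k))) ⟩
  y i * detℚ m B                                     ∎
  where
  open ≡-Reasoning
  repeatedRow≡0 : ∀ t → t ≢ i → y t * detℚ m (setRow B i (B t)) ≡ 0ℚ
  repeatedRow≡0 t t≢i = trans (cong (y t *_) (detℚ-setRow-repeated m B i t (t≢i ∘ sym))) (ℚP.*-zeroʳ (y t))

detℚ-addRowMultiple : ∀ m (B C : Square m) (i k : Fin m) (c : ℚ) → i ≢ k →
  RowsAgreeExcept i C B → (∀ j → C i j ≡ B i j + c * B k j) → detℚ m C ≡ detℚ m B
detℚ-addRowMultiple m B C i k c i≢k C≈B Ci≡ = begin
  detℚ m C
    ≡⟨ detℚ-linearAt m i 1ℚ c C≈B (RowsAgreeExcept-setRow (B k) C≈B) (λ j → trans (Ci≡ j)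
         (cong₂ (λ a b → a + c * b) (sym (ℚP.*-identityˡ (B i j))) (sym (setRow-updates B i (B k) j)))) ⟩
  1ℚ * detℚ m B + c * detℚ m (setRow B i (B k))
    ≡⟨ cong₂ (λ a b → a + c * b) (ℚP.*-identityˡ (detℚ m B)) (detℚ-setRow-repeated m B i k i≢k) ⟩
  detℚ m B + c * 0ℚ                          ≡⟨ cong (detℚ m B +_) (ℚP.*-zeroʳ c) ⟩
  detℚ m B + 0ℚ                              ≡⟨ ℚP.+-identityʳ (detℚ m B) ⟩
  detℚ m B                                   ∎
  where open ≡-Reasoning

addMultiplesOfRow₀ : ∀ {m} → Square (suc m) → (Fin m → ℚ) → Square (suc m)
addMultiplesOfRow₀ X d zero = X zero
addMultiplesOfRow₀ X d (suc i) l = X (suc i) l + d i * X zero l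

detℚ-addMultiplesOfRow₀ : ∀ m (X : Square (suc m)) (d : Fin m → ℚ) →
  detℚ (suc m) (addMultiplesOfRow₀ X d) ≡ detℚ (suc m) X
detℚ-addMultiplesOfRow₀ m X d = supportBelow m ℕP.≤-refl d (λ i m≤i → ⊥-elim (ℕP.<⇒≱ (FinP.toℕ<n i) m≤i))
  where
  supportBelow : ∀ t → t ℕ.≤ m → ∀ d → (∀ i → t ℕ.≤ toℕ i → d i ≡ 0ℚ) →
    detℚ (suc m) (addMultiplesOfRow₀ X d) ≡ detℚ (suc m) X
  supportBelow zero _ d d≡0 = detℚ-cong (suc m) {addMultiplesOfRow₀ X d} {X} λ where
    zero l → refl
    (suc i) l → trans (cong (λ c → X (suc i) l + c * X zero l) (d≡0 i ℕ.z≤n))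
                      (trans (cong (X (suc i) l +_) (ℚP.*-zeroˡ (X zero l))) (ℚP.+-identityʳ _))
  supportBelow (suc t) t<m d d≡0 = trans
    (detℚ-addRowMultiple (suc m) (addMultiplesOfRow₀ X d′) (addMultiplesOfRow₀ X d) (suc iₜ) zero (d iₜ) (λ ())
      agree rowₜ)
    (supportBelow t (ℕP.<⇒≤ t<m) d′ d′≡0)
    where
    iₜ : Fin m
    iₜ = Fin.fromℕ< t<m
    d′ : Fin m → ℚ
    d′ = updateAt d iₜ (λ _ → 0ℚ)
    d′≡0 : ∀ i → t ℕ.≤ toℕ i → d′ i ≡ 0ℚ
    d′≡0 i t≤i with i Fin.≟ iₜ
    ... | yes refl = updateAt-updates iₜ d
    ... | no i≢iₜ = trans (updateAt-minimal i iₜ d i≢iₜ) (d≡0 i (ℕP.≤∧≢⇒< t≤i (λ t≡i →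
            i≢iₜ (FinP.toℕ-injective (trans (sym t≡i) (sym (FinP.toℕ-fromℕ< t<m)))))))
    agree : RowsAgreeExcept (suc iₜ) (addMultiplesOfRow₀ X d) (addMultiplesOfRow₀ X d′)
    agree zero _ l = refl
    agree (suc i) i≢iₜ l = cong (λ c → X (suc i) l + c * X zero l)
      (sym (updateAt-minimal i iₜ d (i≢iₜ ∘ cong suc)))
    rowₜ : ∀ l → X (suc iₜ) l + d iₜ * X zero l ≡ (X (suc iₜ) l + d′ iₜ * X zero l) + d iₜ * X zero l
    rowₜ l = sym (cong (_+ d iₜ * X zero l) (trans (cong (λ c → X (suc iₜ) l + c * X zero l) (updateAt-updates iₜ d))
      (trans (cong (X (suc iₜ) l +_) (ℚP.*-zeroˡ (X zero l))) (ℚP.+-identityʳ (X (suc iₜ) l)))))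

-- Nonvanishing maximal minors

punchIn-mono-< : ∀ {n} (j : Fin (suc n)) {a b : Fin n} → a Fin.< b → punchIn j a Fin.< punchIn j b
punchIn-mono-< zero a<b = ℕ.s≤s a<b
punchIn-mono-< (suc j) {zero} {suc b} _ = ℕ.s≤s ℕ.z≤n
punchIn-mono-< (suc j) {suc a} {suc b} (ℕ.s≤s a<b) = ℕ.s≤s (punchIn-mono-< j a<b)

≤⇒<punchIn : ∀ {n} (j : Fin (suc n)) (x : Fin n) → toℕ j ℕ.≤ toℕ x → j Fin.< punchIn j x
≤⇒<punchIn zero x _ = ℕ.s≤s ℕ.z≤n
≤⇒<punchIn (suc j) (suc x) (ℕ.s≤s j≤x) = ℕ.s≤s (≤⇒<punchIn j x j≤x)

<⇒punchIn< : ∀ {n} (j : Fin (suc n)) (x : Fin n) → toℕ x ℕ.< toℕ j → punchIn j x Fin.< j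
<⇒punchIn< (suc j) zero _ = ℕ.s≤s ℕ.z≤n
<⇒punchIn< (suc j) (suc x) (ℕ.s≤s x<j) = ℕ.s≤s (<⇒punchIn< j x x<j)

record Insertion {m n} (j : Fin (suc n)) (σ′ : Fin m → Fin n) : Set where
  field
    σ : Fin (suc m) → Fin (suc n)
    position : Fin (suc m)
    increasing : StrictlyIncreasing σ
    σ-position : σ position ≡ j
    σ-punchIn : ∀ l → σ (punchIn position l) ≡ punchIn j (σ′ l)

insert : ∀ {m n} (j : Fin (suc n)) (σ′ : Fin m → Fin n) → StrictlyIncreasing σ′ → Insertion j σ′
insert {zero} j σ′ _ = record
  { σ = λ _ → j ; position = zero ; increasing = λ { zero zero () } ; σ-position = refl ; σ-punchIn = λ () }
insert {suc m} j σ′ σ′-inc with toℕ j ℕ.≤? toℕ (σ′ zero)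
... | yes j≤σ′₀ = record
  { σ = σ ; position = zero ; increasing = σ-inc ; σ-position = refl ; σ-punchIn = λ l → refl }
  where
  σ : Fin (suc (suc m)) → Fin _
  σ zero = j
  σ (suc x) = punchIn j (σ′ x)
  σ′₀≤ : ∀ b → toℕ (σ′ zero) ℕ.≤ toℕ (σ′ b)
  σ′₀≤ zero = ℕP.≤-refl
  σ′₀≤ (suc b) = ℕP.<⇒≤ (σ′-inc zero (suc b) (ℕ.s≤s ℕ.z≤n))
  σ-inc : StrictlyIncreasing σ
  σ-inc zero (suc b) _ = ≤⇒<punchIn j (σ′ b) (ℕP.≤-trans j≤σ′₀ (σ′₀≤ b))
  σ-inc (suc a) (suc b) (ℕ.s≤s a<b) = punchIn-mono-< j (σ′-inc a b a<b)
... | no j≰σ′₀ = record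
  { σ = σ ; position = suc position ; increasing = σ-inc ; σ-position = σ-position
  ; σ-punchIn = λ { zero → refl ; (suc l) → σ-punchIn l } }
  where
  open Insertion (insert j (σ′ ∘ suc) (λ a b a<b → σ′-inc (suc a) (suc b) (ℕ.s≤s a<b)))
    renaming (σ to τ; increasing to τ-inc)
  σ : Fin (suc (suc m)) → Fin _
  σ zero = punchIn j (σ′ zero)
  σ (suc x) = τ x
  σ-inc : StrictlyIncreasing σ
  σ-inc zero (suc b) _ with b Fin.≟ position
  ... | yes refl = subst (punchIn j (σ′ zero) Fin.<_) (sym σ-position) (<⇒punchIn< j (σ′ zero) (ℕP.≰⇒> j≰σ′₀))
  ... | no b≢p = subst (λ x → punchIn j (σ′ zero) Fin.< τ x) (FinP.punchIn-punchOut (b≢p ∘ sym))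
        (subst (punchIn j (σ′ zero) Fin.<_) (sym (σ-punchIn _)) (punchIn-mono-< j (σ′-inc zero (suc _) (ℕ.s≤s ℕ.z≤n))))
  σ-inc (suc a) (suc b) (ℕ.s≤s a<b) = τ-inc a b a<b

*-≢0 : ∀ {a b} → a ≢ 0ℚ → b ≢ 0ℚ → a * b ≢ 0ℚ
*-≢0 {a} {b} a≢0 b≢0 ab≡0 = b≢0 (begin
  b                 ≡⟨ sym (ℚP.*-identityˡ b) ⟩
  1ℚ * b            ≡⟨ cong (_* b) (sym (ℚP.*-inverseˡ a)) ⟩
  (1/ a * a) * b    ≡⟨ ℚP.*-assoc (1/ a) a b ⟩
  1/ a * (a * b)    ≡⟨ cong (1/ a *_) ab≡0 ⟩
  1/ a * 0ℚ         ≡⟨ ℚP.*-zeroʳ (1/ a) ⟩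
  0ℚ                ∎)
  where
  open ≡-Reasoning
  instance
    a-nonZero : NonZero a
    a-nonZero = ≢-nonZero a≢0

LinearlyDependentRows : ∀ {m n} → (Fin m → Fin n → ℚ) → Set
LinearlyDependentRows {m} A =
  Σ (Fin m → ℚ) λ y → (Σ (Fin m) λ i → y i ≢ 0ℚ) × (∀ j → sumℚ (λ i → y i * A i j) ≡ 0ℚ)

NonzeroMaximalMinor : ∀ {m n} → (Fin m → Fin n → ℚ) → Set
NonzeroMaximalMinor {m} {n} A =
  Σ (Fin m → Fin n) λ σ → StrictlyIncreasing σ × detℚ m (λ i l → A i (σ l)) ≢ 0ℚ

zeroRow⇒dependent : ∀ {m n} (A : Fin (suc m) → Fin n → ℚ) → (∀ l → A zero l ≡ 0ℚ) → LinearlyDependentRows A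
zeroRow⇒dependent {m} A A₀≡0 = y , (zero , λ ()) , λ l → begin
  1ℚ * A zero l + sumℚ (λ i → 0ℚ * A (suc i) l) ≡⟨ cong₂ _+_ (trans (ℚP.*-identityˡ (A zero l)) (A₀≡0 l))
                                                     (trans (sumℚ-cong (λ i → ℚP.*-zeroˡ (A (suc i) l))) (sumℚ-zero m)) ⟩
  0ℚ + 0ℚ                                       ≡⟨⟩
  0ℚ                                            ∎
  where
  open ≡-Reasoning
  y : Fin (suc m) → ℚ
  y zero = 1ℚ
  y (suc _) = 0ℚ

module Pivot {m n} (A : Fin (suc m) → Fin (suc n) → ℚ) (j : Fin (suc n)) (Aⱼ≢0 : A zero j ≢ 0ℚ) where

  instance
    pivot-nonZero : NonZero (A zero j)
    pivot-nonZero = ≢-nonZero Aⱼ≢0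

  factor : Fin m → ℚ
  factor i = A (suc i) j * 1/ A zero j

  eliminated : Fin m → Fin (suc n) → ℚ
  eliminated i l = A (suc i) l + (- factor i) * A zero l

  eliminated-pivotColumn : ∀ i → eliminated i j ≡ 0ℚ
  eliminated-pivotColumn i = begin
    a + (- (a * 1/ p)) * p  ≡⟨ cancel a (1/ p) p ⟩
    a - a * (1/ p * p)      ≡⟨ cong (λ z → a - a * z) (ℚP.*-inverseˡ p) ⟩
    a - a * 1ℚ              ≡⟨ cong (λ z → a - z) (ℚP.*-identityʳ a) ⟩
    a - a                   ≡⟨ ℚP.+-inverseʳ a ⟩
    0ℚ                      ∎
    where
    open ≡-Reasoning
    a = A (suc i) j
    p = A zero j
    cancel : ∀ a v p → a + (- (a * v)) * p ≡ a - a * (v * p)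
    cancel = solve-∀ ℚ-ring

  remaining : Fin m → Fin n → ℚ
  remaining i l = eliminated i (punchIn j l)

  dependent : LinearlyDependentRows remaining → LinearlyDependentRows A
  dependent (y′ , (i₀ , y′ᵢ₀≢0) , y′remaining≡0) = y , (suc i₀ , y′ᵢ₀≢0) , yA≡0
    where
    y : Fin (suc m) → ℚ
    y zero = - sumℚ (λ i → y′ i * factor i)
    y (suc i) = y′ i
    yA≡y′eliminated : ∀ l → sumℚ (λ i → y i * A i l) ≡ sumℚ (λ i → y′ i * eliminated i l)
    yA≡y′eliminated l = sym (begin
      sumℚ (λ i → y′ i * eliminated i l)
        ≡⟨ sumℚ-cong (λ i → expand (y′ i) (A (suc i) l) (factor i) (A zero l)) ⟩
      sumℚ (λ i → y′ i * A (suc i) l + A zero l * (- (y′ i * factor i)))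
        ≡⟨ sumℚ-distrib-+ (λ i → y′ i * A (suc i) l) (λ i → A zero l * (- (y′ i * factor i))) ⟩
      S + sumℚ (λ i → A zero l * (- (y′ i * factor i)))
        ≡⟨ cong (S +_) (*-distribˡ-sumℚ (A zero l) (λ i → - (y′ i * factor i))) ⟩
      S + A zero l * sumℚ (λ i → - (y′ i * factor i))
        ≡⟨ cong (λ z → S + A zero l * z) (sumℚ-neg (λ i → y′ i * factor i)) ⟩
      S + A zero l * y zero
        ≡⟨ ℚP.+-comm S _ ⟩
      A zero l * y zero + S
        ≡⟨ cong (_+ S) (ℚP.*-comm (A zero l) (y zero)) ⟩
      y zero * A zero l + S ∎)
      where
      open ≡-Reasoning
      S = sumℚ (λ i → y′ i * A (suc i) l)
      expand : ∀ y a c b → y * (a + (- c) * b) ≡ y * a + b * (- (y * c))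
      expand = solve-∀ ℚ-ring
    yA≡0 : ∀ l → sumℚ (λ i → y i * A i l) ≡ 0ℚ
    yA≡0 l with j Fin.≟ l
    ... | yes refl = trans (yA≡y′eliminated j) (trans
            (sumℚ-cong (λ i → trans (cong (y′ i *_) (eliminated-pivotColumn i)) (ℚP.*-zeroʳ (y′ i))))
            (sumℚ-zero m))
    ... | no j≢l = trans (yA≡y′eliminated l)
                   (subst (λ z → sumℚ (λ i → y′ i * eliminated i z) ≡ 0ℚ) (FinP.punchIn-punchOut j≢l)
                          (y′remaining≡0 (punchOut j≢l)))

  nonzeroMinor : NonzeroMaximalMinor remaining → NonzeroMaximalMinor A
  nonzeroMinor (σ′ , σ′-inc , det≢0) = σ , increasing , detX≢0
    where
    open Insertion (insert j σ′ σ′-inc)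
    X : Square (suc m)
    X i l = A i (σ l)
    detX≡ : detℚ (suc m) X ≡ sgnℚ (toℕ position) * (A zero j * detℚ m (λ i l → remaining i (σ′ l)))
    detX≡ = begin
      detℚ (suc m) X
        ≡⟨ sym (detℚ-addMultiplesOfRow₀ m X (λ i → - factor i)) ⟩
      detℚ (suc m) (addMultiplesOfRow₀ X (λ i → - factor i))
        ≡⟨ detℚ-pivotColumn m (addMultiplesOfRow₀ X (λ i → - factor i)) position
             (λ i → trans (cong (eliminated i) σ-position) (eliminated-pivotColumn i)) ⟩
      sgnℚ (toℕ position) * (A zero (σ position) * detℚ m (λ i l → eliminated i (σ (punchIn position l))))
        ≡⟨ cong₂ (λ a d → sgnℚ (toℕ position) * (A zero a * d)) σ-position
             (detℚ-cong m (λ i l → cong (eliminated i) (σ-punchIn l))) ⟩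
      sgnℚ (toℕ position) * (A zero j * detℚ m (λ i l → remaining i (σ′ l))) ∎
      where open ≡-Reasoning
    detX≢0 : detℚ (suc m) X ≢ 0ℚ
    detX≢0 detX≡0 = *-≢0 (sgnℚ≢0 (toℕ position)) (*-≢0 Aⱼ≢0 det≢0) (trans (sym detX≡) detX≡0)

dependentRows⊎nonzeroMinor : ∀ m n (A : Fin m → Fin n → ℚ) → LinearlyDependentRows A ⊎ NonzeroMaximalMinor A
dependentRows⊎nonzeroMinor zero n A = inj₂ ((λ ()) , (λ ()) , λ ())
dependentRows⊎nonzeroMinor (suc m) zero A = inj₁ (zeroRow⇒dependent A (λ ()))
dependentRows⊎nonzeroMinor (suc m) (suc n) A with FinP.all? (λ l → A zero l ℚP.≟ 0ℚ)
... | yes A₀≡0 = inj₁ (zeroRow⇒dependent A A₀≡0)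
... | no A₀≢0 with FinP.¬∀⟶∃¬ (suc n) (λ l → A zero l ≡ 0ℚ) (λ l → A zero l ℚP.≟ 0ℚ) A₀≢0
...   | j , Aⱼ≢0 = Sum.map (Pivot.dependent A j Aⱼ≢0) (Pivot.nonzeroMinor A j Aⱼ≢0)
                     (dependentRows⊎nonzeroMinor m n (Pivot.remaining A j Aⱼ≢0))

-- The polytope and its polar

transposeApplyℚ : ∀ {r n} → Mat r n → (Fin r → ℚ) → Fin n → ℚ
transposeApplyℚ M v j = sumℚ (λ a → v a * toℚ (M a j))

transposeApplyℚ-scale : ∀ {r n} (M : Mat r n) (c : ℚ) (v : Fin r → ℚ) j →
  transposeApplyℚ M (λ a → c * v a) j ≡ c * transposeApplyℚ M v j
transposeApplyℚ-scale M c v j =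
  trans (sumℚ-cong (λ a → ℚP.*-assoc c (v a) (toℚ (M a j)))) (*-distribˡ-sumℚ c (λ a → v a * toℚ (M a j)))

transposeApplyℚ-sub : ∀ {r n} (M : Mat r n) (v v′ : Fin r → ℚ) j →
  transposeApplyℚ M (λ a → v a - v′ a) j ≡ transposeApplyℚ M v j - transposeApplyℚ M v′ j
transposeApplyℚ-sub M v v′ j = begin
  sumℚ (λ a → (v a - v′ a) * toℚ (M a j))
    ≡⟨ sumℚ-cong (λ a → trans (ℚP.*-distribʳ-+ (toℚ (M a j)) (v a) (- v′ a))
                             (cong (v a * toℚ (M a j) +_) (sym (ℚP.neg-distribˡ-* (v′ a) (toℚ (M a j)))))) ⟩
  sumℚ (λ a → v a * toℚ (M a j) - v′ a * toℚ (M a j))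
    ≡⟨ sumℚ-distrib-+ (λ a → v a * toℚ (M a j)) (λ a → - (v′ a * toℚ (M a j))) ⟩
  transposeApplyℚ M v j + sumℚ (λ a → - (v′ a * toℚ (M a j)))
    ≡⟨ cong (transposeApplyℚ M v j +_) (sumℚ-neg (λ a → v′ a * toℚ (M a j))) ⟩
  transposeApplyℚ M v j - transposeApplyℚ M v′ j ∎
  where open ≡-Reasoning

toℚ-transposeApply : ∀ {r n} (M : Mat r n) (u : Fin r → ℤ) j →
  toℚ (transposeApply M u j) ≡ transposeApplyℚ M (toℚ ∘ u) j
toℚ-transposeApply M u j = trans (toℚ-sumℤ (λ a → M a j ℤ.* u a))
  (sumℚ-cong (λ a → trans (toℚ-* (M a j) (u a)) (ℚP.*-comm (toℚ (M a j)) (toℚ (u a)))))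

WithinBox : ∀ {n} → ℚ → (Fin n → ℚ) → Set
WithinBox b w = ∀ j → w j ≤ b × - w j ≤ b

unitVector : ∀ {n} → Fin n → Fin n → ℚ
unitVector j l with l Fin.≟ j
... | yes _ = 1ℚ
... | no _ = 0ℚ

unitVector-nonNeg : ∀ {n} (j l : Fin n) → 0ℚ ≤ unitVector j l
unitVector-nonNeg j l with l Fin.≟ j
... | yes _ = ℚP.nonNegative⁻¹ 1ℚ
... | no _ = ℚP.≤-refl

sumℚ-unitVector-* : ∀ {n} (j : Fin n) (g : Fin n → ℚ) → sumℚ (λ l → unitVector j l * g l) ≡ g j
sumℚ-unitVector-* j g = trans (sumℚ-single _ j off-j) at-j
  where
  off-j : ∀ l → l ≢ j → unitVector j l * g l ≡ 0ℚ
  off-j l l≢j with l Fin.≟ j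
  ... | yes l≡j = ⊥-elim (l≢j l≡j)
  ... | no _ = ℚP.*-zeroˡ (g l)
  at-j : unitVector j j * g j ≡ g j
  at-j with j Fin.≟ j
  ... | yes _ = ℚP.*-identityˡ (g j)
  ... | no j≢j = ⊥-elim (j≢j refl)

sumℚ-unitVector : ∀ {n} (j : Fin n) → sumℚ (unitVector j) ≡ 1ℚ
sumℚ-unitVector j = trans (sumℚ-cong (λ l → sym (ℚP.*-identityʳ (unitVector j l)))) (sumℚ-unitVector-* j (λ _ → 1ℚ))

sumℚ-zero-* : ∀ {n} (g : Fin n → ℚ) → sumℚ (λ l → 0ℚ * g l) ≡ 0ℚ
sumℚ-zero-* {n} g = trans (sumℚ-cong (λ l → ℚP.*-zeroˡ (g l))) (sumℚ-zero n)

column∈P : ∀ {r n} (M : Mat r n) (j : Fin n) → InP M (λ a → toℚ (M a j))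
column∈P {n = n} M j = unitVector j , (λ _ → 0ℚ) , unitVector-nonNeg j , (λ _ → ℚP.≤-refl) ,
  cong₂ _+_ (sumℚ-unitVector j) (sumℚ-zero n) ,
  λ a → sym (begin
    sumℚ (λ l → unitVector j l * toℚ (M a l) + 0ℚ * toℚ (ℤ.- M a l))
      ≡⟨ sumℚ-distrib-+ (λ l → unitVector j l * toℚ (M a l)) (λ l → 0ℚ * toℚ (ℤ.- M a l)) ⟩
    sumℚ (λ l → unitVector j l * toℚ (M a l)) + sumℚ (λ l → 0ℚ * toℚ (ℤ.- M a l))
      ≡⟨ cong₂ _+_ (sumℚ-unitVector-* j (λ l → toℚ (M a l))) (sumℚ-zero-* (λ l → toℚ (ℤ.- M a l))) ⟩
    toℚ (M a j) + 0ℚ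
      ≡⟨ ℚP.+-identityʳ _ ⟩
    toℚ (M a j) ∎)
  where open ≡-Reasoning

negatedColumn∈P : ∀ {r n} (M : Mat r n) (j : Fin n) → InP M (λ a → toℚ (ℤ.- M a j))
negatedColumn∈P {n = n} M j = (λ _ → 0ℚ) , unitVector j , (λ _ → ℚP.≤-refl) , unitVector-nonNeg j ,
  cong₂ _+_ (sumℚ-zero n) (sumℚ-unitVector j) ,
  λ a → sym (begin
    sumℚ (λ l → 0ℚ * toℚ (M a l) + unitVector j l * toℚ (ℤ.- M a l))
      ≡⟨ sumℚ-distrib-+ (λ l → 0ℚ * toℚ (M a l)) (λ l → unitVector j l * toℚ (ℤ.- M a l)) ⟩
    sumℚ (λ l → 0ℚ * toℚ (M a l)) + sumℚ (λ l → unitVector j l * toℚ (ℤ.- M a l))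
      ≡⟨ cong₂ _+_ (sumℚ-zero-* (λ l → toℚ (M a l))) (sumℚ-unitVector-* j (λ l → toℚ (ℤ.- M a l))) ⟩
    0ℚ + toℚ (ℤ.- M a j)
      ≡⟨ ℚP.+-identityˡ _ ⟩
    toℚ (ℤ.- M a j) ∎)
  where open ≡-Reasoning

inPolar⇒withinBox : ∀ {r n} (M : Mat r n) (v : Fin r → ℚ) → InPolar M v → WithinBox 1ℚ (transposeApplyℚ M v)
inPolar⇒withinBox M v v∈P° j = v∈P° _ (column∈P M j) , subst (_≤ 1ℚ) negated (v∈P° _ (negatedColumn∈P M j))
  where
  negated : sumℚ (λ a → v a * toℚ (ℤ.- M a j)) ≡ - transposeApplyℚ M v j
  negated = trans (sumℚ-cong (λ a → trans (cong (v a *_) (toℚ-neg (M a j))) (sym (ℚP.neg-distribʳ-* (v a) (toℚ (M a j))))))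
                  (sumℚ-neg (λ a → v a * toℚ (M a j)))

withinBox⇒inPolar : ∀ {r n} (M : Mat r n) (v : Fin r → ℚ) → WithinBox 1ℚ (transposeApplyℚ M v) → InPolar M v
withinBox⇒inPolar M v box x (λ⁺ , λ⁻ , λ⁺≥0 , λ⁻≥0 , Σλ≡1 , x≡) = begin
  sumℚ (λ a → v a * x a)                 ≡⟨ pairing ⟩
  sumℚ (λ j → λ⁺ j * w j + λ⁻ j * - w j) ≤⟨ sumℚ-mono-≤ termwise ⟩
  sumℚ (λ j → λ⁺ j + λ⁻ j)               ≡⟨ trans (sumℚ-distrib-+ λ⁺ λ⁻) Σλ≡1 ⟩
  1ℚ                                     ∎
  where
  open ℚP.≤-Reasoning
  w = transposeApplyℚ M v
  pairing : sumℚ (λ a → v a * x a) ≡ sumℚ (λ j → λ⁺ j * w j + λ⁻ j * - w j)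
  pairing = begin-equality
    sumℚ (λ a → v a * x a)
      ≡⟨ sumℚ-cong (λ a → trans (cong (v a *_) (x≡ a))
           (sym (*-distribˡ-sumℚ (v a) (λ j → λ⁺ j * toℚ (M a j) + λ⁻ j * toℚ (ℤ.- M a j))))) ⟩
    sumℚ (λ a → sumℚ (λ j → v a * (λ⁺ j * toℚ (M a j) + λ⁻ j * toℚ (ℤ.- M a j))))
      ≡⟨ sumℚ-cong (λ a → sumℚ-cong (λ j → trans (cong (λ y → v a * (λ⁺ j * toℚ (M a j) + λ⁻ j * y)) (toℚ-neg (M a j)))
           (regroup (v a) (λ⁺ j) (λ⁻ j) (toℚ (M a j))))) ⟩
    sumℚ (λ a → sumℚ (λ j → λ⁺ j * (v a * toℚ (M a j)) + λ⁻ j * - (v a * toℚ (M a j))))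
      ≡⟨ sumℚ-comm (λ a j → λ⁺ j * (v a * toℚ (M a j)) + λ⁻ j * - (v a * toℚ (M a j))) ⟩
    sumℚ (λ j → sumℚ (λ a → λ⁺ j * (v a * toℚ (M a j)) + λ⁻ j * - (v a * toℚ (M a j))))
      ≡⟨ sumℚ-cong (λ j → trans (sumℚ-distrib-+ (λ a → λ⁺ j * (v a * toℚ (M a j))) (λ a → λ⁻ j * - (v a * toℚ (M a j))))
           (cong₂ _+_ (*-distribˡ-sumℚ (λ⁺ j) (λ a → v a * toℚ (M a j)))
             (trans (*-distribˡ-sumℚ (λ⁻ j) (λ a → - (v a * toℚ (M a j))))
                    (cong (λ⁻ j *_) (sumℚ-neg (λ a → v a * toℚ (M a j))))))) ⟩
    sumℚ (λ j → λ⁺ j * w j + λ⁻ j * - w j) ∎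
    where
    regroup : ∀ v p q m → v * (p * m + q * - m) ≡ p * (v * m) + q * - (v * m)
    regroup = solve-∀ ℚ-ring
  termwise : ∀ j → λ⁺ j * w j + λ⁻ j * - w j ≤ λ⁺ j + λ⁻ j
  termwise j = ℚP.+-mono-≤
    (subst (λ⁺ j * w j ≤_) (ℚP.*-identityʳ (λ⁺ j)) (ℚP.*-monoˡ-≤-nonNeg (λ⁺ j) {{nonNegative (λ⁺≥0 j)}} (proj₁ (box j))))
    (subst (λ⁻ j * - w j ≤_) (ℚP.*-identityʳ (λ⁻ j)) (ℚP.*-monoˡ-≤-nonNeg (λ⁻ j) {{nonNegative (λ⁻≥0 j)}} (proj₂ (box j))))

∣i∣≤n⇒±i≤n : ∀ i n → ∣ i ∣ ℕ.≤ n → i ℤ.≤ ℤ.+ n × ℤ.- i ℤ.≤ ℤ.+ n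
∣i∣≤n⇒±i≤n (ℤ.+ zero) n _ = ℤ.+≤+ ℕ.z≤n , ℤ.+≤+ ℕ.z≤n
∣i∣≤n⇒±i≤n (ℤ.+ suc m) n ∣i∣≤n = ℤ.+≤+ ∣i∣≤n , ℤ.-≤+
∣i∣≤n⇒±i≤n -[1+ m ] n ∣i∣≤n = ℤ.-≤+ , ℤ.+≤+ ∣i∣≤n

±i≤n⇒∣i∣≤n : ∀ i n → i ℤ.≤ ℤ.+ n → ℤ.- i ℤ.≤ ℤ.+ n → ∣ i ∣ ℕ.≤ n
±i≤n⇒∣i∣≤n (ℤ.+ m) n (ℤ.+≤+ m≤n) _ = m≤n
±i≤n⇒∣i∣≤n -[1+ m ] n _ (ℤ.+≤+ m<n) = m<n

inDilatedPolar⇒∣transposeApply∣≤ : ∀ {r n} k (M : Mat r n) (u : Fin r → ℤ) → InDilatedPolarℤ k M u →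
  ∀ j → ∣ transposeApply M u j ∣ ℕ.≤ k
inDilatedPolar⇒∣transposeApply∣≤ k M u (v , v∈P° , u≡kv) j =
  ±i≤n⇒∣i∣≤n (transposeApply M u j) k (≤k scaled upper)
    (≤k (trans (toℚ-neg (transposeApply M u j))
               (trans (cong -_ scaled) (ℚP.neg-distribʳ-* K (transposeApplyℚ M v j)))) lower)
  where
  open ℚP.≤-Reasoning
  K = toℚ (ℤ.+ k)
  instance
    K-nonNeg : NonNegative K
    K-nonNeg = nonNegative (toℚ-mono-≤ {ℤ.+ 0} {ℤ.+ k} (ℤ.+≤+ ℕ.z≤n))
  upper = proj₁ (inPolar⇒withinBox M v v∈P° j)
  lower = proj₂ (inPolar⇒withinBox M v v∈P° j)
  scaled : toℚ (transposeApply M u j) ≡ K * transposeApplyℚ M v j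
  scaled = trans (toℚ-transposeApply M u j)
    (trans (sumℚ-cong (λ a → cong (_* toℚ (M a j)) (u≡kv a))) (transposeApplyℚ-scale M K v j))
  ≤k : ∀ {g w} → toℚ g ≡ K * w → w ≤ 1ℚ → g ℤ.≤ ℤ.+ k
  ≤k {g} {w} g≡Kw w≤1 = toℚ-cancel-≤ (begin
    toℚ g   ≡⟨ g≡Kw ⟩
    K * w   ≤⟨ ℚP.*-monoˡ-≤-nonNeg K w≤1 ⟩
    K * 1ℚ  ≡⟨ ℚP.*-identityʳ K ⟩
    K       ∎)

∣transposeApply∣≤⇒inDilatedPolar : ∀ {r n} k (M : Mat r n) (u : Fin r → ℤ) →
  (∀ j → ∣ transposeApply M u j ∣ ℕ.≤ suc k) → InDilatedPolarℤ (suc k) M u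
∣transposeApply∣≤⇒inDilatedPolar k M u bounded = v , withinBox⇒inPolar M v box , u≡Kv
  where
  K = fromℤ (ℤ.+ suc k)
  v : Fin _ → ℚ
  v a = 1/ K * toℚ (u a)
  u≡Kv : ∀ a → toℚ (u a) ≡ toℚ (ℤ.+ suc k) * v a
  u≡Kv a = sym (begin-equality
    toℚ (ℤ.+ suc k) * (1/ K * toℚ (u a)) ≡⟨ cong (_* v a) (toℚ≡fromℤ (ℤ.+ suc k)) ⟩
    K * (1/ K * toℚ (u a))               ≡⟨ sym (ℚP.*-assoc K (1/ K) (toℚ (u a))) ⟩
    (K * 1/ K) * toℚ (u a)               ≡⟨ cong (_* toℚ (u a)) (ℚP.*-inverseʳ K) ⟩
    1ℚ * toℚ (u a)                       ≡⟨ ℚP.*-identityˡ (toℚ (u a)) ⟩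
    toℚ (u a)                            ∎)
    where open ℚP.≤-Reasoning
  ≤1 : ∀ {g} → g ℤ.≤ ℤ.+ suc k → 1/ K * toℚ g ≤ 1ℚ
  ≤1 {g} g≤K = begin
    1/ K * toℚ g  ≤⟨ ℚP.*-monoˡ-≤-nonNeg (1/ K) (subst (toℚ g ≤_) (toℚ≡fromℤ (ℤ.+ suc k)) (toℚ-mono-≤ g≤K)) ⟩
    1/ K * K      ≡⟨ ℚP.*-inverseˡ K ⟩
    1ℚ            ∎
    where open ℚP.≤-Reasoning
  box : WithinBox 1ℚ (transposeApplyℚ M v)
  box j = subst (_≤ 1ℚ) (sym Mᵀv≡) (≤1 (proj₁ ±Mᵀu≤K)) ,
          subst (_≤ 1ℚ) (trans (cong (1/ K *_) (toℚ-neg (transposeApply M u j)))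
                          (trans (sym (ℚP.neg-distribʳ-* (1/ K) (toℚ (transposeApply M u j)))) (cong -_ (sym Mᵀv≡))))
            (≤1 (proj₂ ±Mᵀu≤K))
    where
    ±Mᵀu≤K = ∣i∣≤n⇒±i≤n (transposeApply M u j) (suc k) (bounded j)
    Mᵀv≡ : transposeApplyℚ M v j ≡ 1/ K * toℚ (transposeApply M u j)
    Mᵀv≡ = trans (transposeApplyℚ-scale M (1/ K) (toℚ ∘ u) j) (cong (1/ K *_) (sym (toℚ-transposeApply M u j)))

transposeApply-injective : ∀ {r n} (M : Mat r n) → HasFullRowRank M →
  ∀ (u u′ : Fin r → ℤ) → (∀ j → transposeApply M u j ≡ transposeApply M u′ j) → ∀ a → u a ≡ u′ a
transposeApply-injective M fullRank u u′ Mᵀu≡Mᵀu′ a =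
  toℚ-injective (x∙y⁻¹≈ε⇒x≈y (toℚ (u a)) (toℚ (u′ a)) (fullRank (λ b → toℚ (u b) - toℚ (u′ b)) Mᵀ[u-u′]≡0 a))
  where
  Mᵀ[u-u′]≡0 : ∀ j → transposeApplyℚ M (λ b → toℚ (u b) - toℚ (u′ b)) j ≡ 0ℚ
  Mᵀ[u-u′]≡0 j = begin
    transposeApplyℚ M (λ b → toℚ (u b) - toℚ (u′ b)) j
      ≡⟨ transposeApplyℚ-sub M (toℚ ∘ u) (toℚ ∘ u′) j ⟩
    transposeApplyℚ M (toℚ ∘ u) j - transposeApplyℚ M (toℚ ∘ u′) j
      ≡⟨ cong₂ _-_ (sym (toℚ-transposeApply M u j)) (sym (toℚ-transposeApply M u′ j)) ⟩
    toℚ (transposeApply M u j) - toℚ (transposeApply M u′ j)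
      ≡⟨ cong (λ x → toℚ (transposeApply M u j) - toℚ x) (sym (Mᵀu≡Mᵀu′ j)) ⟩
    toℚ (transposeApply M u j) - toℚ (transposeApply M u j)
      ≡⟨ ℚP.+-inverseʳ (toℚ (transposeApply M u j)) ⟩
    0ℚ ∎
    where open ≡-Reasoning

-- Cramer's rule: yₐ = det(B with row a replaced by b) · det B, since det B = ±1.
unimodularSolution-integral : ∀ m (B : Fin m → Fin m → ℤ) (b : Fin m → ℤ) (y : Fin m → ℚ) →
  det m B ℤ.* det m B ≡ ℤ.+ 1 → (∀ l → toℚ (b l) ≡ sumℚ (λ a → y a * toℚ (B a l))) →
  Σ (Fin m → ℤ) λ u → ∀ a → toℚ (u a) ≡ y a
unimodularSolution-integral m B b y δ²≡1 b≡yB = (λ a → det m (replaced a) ℤ.* δ) , λ a → begin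
  toℚ (det m (replaced a) ℤ.* δ)            ≡⟨ toℚ-* (det m (replaced a)) δ ⟩
  toℚ (det m (replaced a)) * toℚ δ          ≡⟨ cong (_* toℚ δ) (numerator a) ⟩
  (y a * toℚ δ) * toℚ δ                     ≡⟨ ℚP.*-assoc (y a) (toℚ δ) (toℚ δ) ⟩
  y a * (toℚ δ * toℚ δ)                     ≡⟨ cong (y a *_) (trans (sym (toℚ-* δ δ)) (cong toℚ δ²≡1)) ⟩
  y a * 1ℚ                                  ≡⟨ ℚP.*-identityʳ (y a) ⟩
  y a                                       ∎
  where
  open ≡-Reasoning
  δ = det m B
  replaced : Fin m → Fin m → Fin m → ℤ
  replaced a = updateAt B a (λ _ → b)
  numerator : ∀ a → toℚ (det m (replaced a)) ≡ y a * toℚ δ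
  numerator a = trans (toℚ-det m (replaced a)) (trans
    (detℚ-cramer m (λ i l → toℚ (B i l)) (λ i l → toℚ (replaced a i l)) a y
      (λ i i≢a l → cong (λ row → toℚ (row l)) (updateAt-minimal i a B i≢a))
      (λ l → trans (cong (λ row → toℚ (row l)) (updateAt-updates a B)) (b≡yB l)))
    (cong (y a *_) (sym (toℚ-det m B))))

nonzeroMinor²≡1 : ∀ {r n} (M : Mat r n) → FullRankWeaklyUnimodular M → ∀ σ → StrictlyIncreasing σ →
  detℚ r (λ i l → toℚ (M i (σ l))) ≢ 0ℚ → minor M σ ℤ.* minor M σ ≡ ℤ.+ 1
nonzeroMinor²≡1 {r} M (_ , unimodular) σ σ-inc minor≢0 with unimodular σ σ-inc
... | inj₁ minor≡0 = ⊥-elim (minor≢0 (trans (sym (toℚ-det r (λ i l → M i (σ l)))) (cong toℚ minor≡0)))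
... | inj₂ (inj₁ minor≡1) rewrite minor≡1 = refl
... | inj₂ (inj₂ minor≡-1) rewrite minor≡-1 = refl

integralPreimage : ∀ {r n} (M : Mat r n) → FullRankWeaklyUnimodular M →
  ∀ γ → InCutLattice M γ → Σ (Fin r → ℤ) λ u → ∀ j → transposeApply M u j ≡ γ j
integralPreimage {r} {n} M weaklyUnimodular γ (y , γ≡yM)
  with dependentRows⊎nonzeroMinor r n (λ a j → toℚ (M a j))
... | inj₁ (y′ , (a , y′ₐ≢0) , y′M≡0) = ⊥-elim (y′ₐ≢0 (proj₁ weaklyUnimodular y′ y′M≡0 a))
... | inj₂ (σ , σ-inc , minor≢0)
  with unimodularSolution-integral r (λ i l → M i (σ l)) (γ ∘ σ) y
         (nonzeroMinor²≡1 M weaklyUnimodular σ σ-inc minor≢0) (γ≡yM ∘ σ)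
...   | u , u≡y = u , λ j → toℚ-injective (begin
  toℚ (transposeApply M u j)            ≡⟨ toℚ-transposeApply M u j ⟩
  transposeApplyℚ M (toℚ ∘ u) j         ≡⟨ sumℚ-cong (λ a → cong (_* toℚ (M a j)) (u≡y a)) ⟩
  sumℚ (λ a → y a * toℚ (M a j))        ≡⟨ sym (γ≡yM j) ⟩
  toℚ (γ j)                             ∎)
  where open ≡-Reasoning

proposition5p1 :
    ∀ (k r n : ℕ) (M : Mat r n) →
    1 ℕ.≤ k → 0 ℕ.< r → r ℕ.≤ n →
    FullRankWeaklyUnimodular M →
    SimpleMatroidOf M →
    (∀ (u : Fin r → ℤ) → InDilatedPolarℤ k M u → IsCut (suc k) M (transposeApply M u))
    × (∀ (u u′ : Fin r → ℤ) → InDilatedPolarℤ k M u → InDilatedPolarℤ k M u′ →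
         (∀ j → transposeApply M u j ≡ transposeApply M u′ j) → ∀ a → u a ≡ u′ a)
    × (∀ (γ : Fin n → ℤ) → IsCut (suc k) M γ →
         Σ (Fin r → ℤ) λ u → InDilatedPolarℤ k M u × (∀ j → transposeApply M u j ≡ γ j))
proposition5p1 (suc k) r n M (ℕ.s≤s ℕ.z≤n) _ _ weaklyUnimodular _ = well-defined , injective , surjective
  where
  well-defined : ∀ u → InDilatedPolarℤ (suc k) M u → IsCut (suc (suc k)) M (transposeApply M u)
  well-defined u u∈kP° =
    (toℚ ∘ u , toℚ-transposeApply M u) , λ j → ℕ.s≤s (inDilatedPolar⇒∣transposeApply∣≤ (suc k) M u u∈kP° j)
  injective : ∀ u u′ → InDilatedPolarℤ (suc k) M u → InDilatedPolarℤ (suc k) M u′ →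
    (∀ j → transposeApply M u j ≡ transposeApply M u′ j) → ∀ a → u a ≡ u′ a
  injective u u′ _ _ = transposeApply-injective M (proj₁ weaklyUnimodular) u u′
  surjective : ∀ γ → IsCut (suc (suc k)) M γ →
    Σ (Fin r → ℤ) λ u → InDilatedPolarℤ (suc k) M u × (∀ j → transposeApply M u j ≡ γ j)
  surjective γ (γ∈Γ , ∣γ∣<k+2) with integralPreimage M weaklyUnimodular γ γ∈Γ
  ... | u , Mᵀu≡γ = u , ∣transposeApply∣≤⇒inDilatedPolar k M u
                          (λ j → subst (λ g → ∣ g ∣ ℕ.≤ suc k) (sym (Mᵀu≡γ j)) (ℕP.≤-pred (∣γ∣<k+2 j))) , Mᵀu≡γ
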